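{- Let $V$ be a finite subset of the positive integers and $\sigma$ a matching of $V$. Then the heaps $m\in M$ with $\Phi(m)=\sigma$ are in bijection with the acyclic orientations of the crossing graph $G(\sigma)$.
   Context: $M$ is the monoid generated by $(x_{ij})_{1\le i<j}$ subject to $x_{ij}x_{k\ell}=x_{k\ell}x_{ij}$ whenever $i<j<k<\ell$ or $i<k<\ell<j$; its elements are heaps. For a heap represented by a word $x_{i_1j_1}\cdots x_{i_nj_n}$, $\Phi(m)=\{\{i_1,j_1\},\dots,\{i_n,j_n\}\}$ (a multiset of pairs, independent of the representing word). A matching of $V$ is a set partition of $V$ into blocks (arches) of size 2. The crossing graph $G(\sigma)$ has the arches of $\sigma$ as vertices, with an edge between $\{i,j\}$ and $\{k,\ell\}$ iff $i<k<j<\ell$. -}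

module Defs where

open import Data.Nat using (ℕ; _≤_; _<_)
open import Data.Product using (_×_; _,_; proj₁; proj₂; Σ)
open import Data.Sum using (_⊎_)
open import Data.Bool using (Bool; true; false; not)
open import Data.Fin using (Fin)
open import Data.List using (List; []; _∷_; _++_; map; concatMap; length; lookup)
open import Data.List.Relation.Unary.All using (All)
open import Data.List.Relation.Unary.Unique.Propositional using (Unique)
open import Data.List.Relation.Binary.Permutation.Propositional using (_↭_)
open import Relation.Binary.PropositionalEquality using (_≡_)
open import Relation.Binary.Bundles using (Setoid)
open import Relation.Binary.Construct.Closure.Equivalence using (EqClosure)
open import Relation.Binary.Construct.Closure.Transitive using (TransClosure)
open import Relation.Nullary using (¬_)

record Letter : Set where
  constructor x
  field
    i j  : ℕ
    .pos : 1 ≤ i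
    .lt  : i < j
open Letter public

pairOf : Letter → ℕ × ℕ
pairOf a = i a , j a

-- x_{ij} x_{kl} = x_{kl} x_{ij} whenever i<j<k<l or i<k<l<j
-- (i<j and k<l are automatic for letters).
Commute : Letter → Letter → Set
Commute a b = (j a < i b) ⊎ ((i a < i b) × (j b < j a))

data Step : List Letter → List Letter → Set where
  swap : ∀ (u v : List Letter) (a b : Letter) → Commute a b →
         Step (u ++ a ∷ b ∷ v) (u ++ b ∷ a ∷ v)

_≈M_ : List Letter → List Letter → Set
_≈M_ = EqClosure Step

-- Φ of a representing word, as a list (a multiset up to _↭_).
Φ : List Letter → List (ℕ × ℕ)
Φ w = map pairOf w

-- Matchings.  V is a finite set of positive integers given as a
-- duplicate-free list; a matching σ of V is a list of arches (i , j)
-- with i < j whose blocks {i , j} partition V.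

IsPosFinSet : List ℕ → Set
IsPosFinSet V = Unique V × All (1 ≤_) V

IsMatching : List ℕ → List (ℕ × ℕ) → Set
IsMatching V σ =
  All (λ p → proj₁ p < proj₂ p) σ ×
  (concatMap (λ p → proj₁ p ∷ proj₂ p ∷ []) σ ↭ V)

-- Heaps m ∈ M with Φ(m) = σ, as a setoid of representing words.

HeapsWithΦ : List (ℕ × ℕ) → Setoid _ _
HeapsWithΦ σ = record
  { Carrier = Σ (List Letter) (λ w → Φ w ↭ σ)
  ; _≈_ = λ p q → proj₁ p ≈M proj₁ q
  ; isEquivalence = record
    { refl = Relation.Binary.Construct.Closure.Equivalence.reflexive Step
    ; sym = Relation.Binary.Construct.Closure.Equivalence.symmetric Step
    ; trans = Relation.Binary.Construct.Closure.Equivalence.transitive Step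
    }
  }
  where import Relation.Binary.Construct.Closure.Equivalence

Arch : (σ : List (ℕ × ℕ)) → Fin (length σ) → ℕ × ℕ
Arch σ = lookup σ

Crosses : ℕ × ℕ → ℕ × ℕ → Set
Crosses (i , j) (k , l) = (i < k) × (k < j) × (j < l)

Edge : (σ : List (ℕ × ℕ)) → Fin (length σ) → Fin (length σ) → Set
Edge σ a b = Crosses (Arch σ a) (Arch σ b) ⊎ Crosses (Arch σ b) (Arch σ a)

-- An acyclic orientation of G(σ): each edge gets exactly one direction
-- (dir a b ≡ true means a → b), non-edges get none, and the resulting
-- digraph has no directed cycle.
record AcyclicOrientation (σ : List (ℕ × ℕ)) : Set where
  field
    dir      : Fin (length σ) → Fin (length σ) → Bool
    onEdge   : ∀ a b → Edge σ a b → dir a b ≡ not (dir b a)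
    offEdge  : ∀ a b → ¬ Edge σ a b → dir a b ≡ false
    acyclic  : ∀ a → ¬ TransClosure (λ c d → dir c d ≡ true) a a
open AcyclicOrientation public

AcyclicOrientations : List (ℕ × ℕ) → Setoid _ _
AcyclicOrientations σ = record
  { Carrier = AcyclicOrientation σ
  ; _≈_ = λ o o′ → ∀ a b → dir o a b ≡ dir o′ a b
  ; isEquivalence = record
    { refl = λ a b → Relation.Binary.PropositionalEquality.refl
    ; sym = λ p a b → Relation.Binary.PropositionalEquality.sym (p a b)
    ; trans = λ p q a b → Relation.Binary.PropositionalEquality.trans (p a b) (q a b)
    }
  }
  where import Relation.Binary.PropositionalEquality

-- A word w with Φ w = σ uses each arch of σ exactly once, so it orients every pair of crossing arches
-- from the earlier occurrence to the later one; this orientation is acyclic because it is contained in the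
-- order of positions in w. As the arches of σ are pairwise disjoint, two of its letters commute exactly when
-- their arches do not cross, so commutations never reorder a crossing pair and the orientation depends only
-- on the heap. Conversely, listing the letters along a linear extension of an acyclic orientation realizes
-- it, and two words inducing the same orientation are equal in M: the first letter of one word is preceded
-- in the other only by letters it does not cross, hence commutes with them to the front, and one recurses.
module Submission where

open import Defs
open import Data.Bool as Bool using (Bool; true; false; not; if_then_else_; _∧_)
open import Data.Bool.Properties using (not-injective)
open import Data.Empty using (⊥-elim)
open import Data.Fin as Fin using (Fin; toℕ)
open import Data.Fin.Properties using (pigeonhole)
open import Data.List using (List; []; _∷_; _++_; map; concatMap; length; lookup; allFin)
open import Data.List.Properties using (map-++; map-∘; map-tabulate; tabulate-lookup)
open import Data.List.Membership.Propositional using (_∈_; _∉_; find; lose)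
open import Data.List.Membership.Propositional.Properties
  using (∈-map⁺; ∈-map⁻; ∈-∃++; ∈-++⁺ˡ; ∈-++⁺ʳ; ∈-lookup; ∈-allFin)
open import Data.List.Relation.Unary.All as All using (All; _∷_)
open import Data.List.Relation.Unary.AllPairs as AllPairs using ([]; _∷_)
open import Data.List.Relation.Unary.Any using (Any; here; there; any?; index)
open import Data.List.Relation.Unary.Any.Properties using (lookup-index)
open import Data.List.Relation.Unary.Unique.Propositional using (Unique)
open import Data.List.Relation.Unary.Unique.Propositional.Properties using (Unique[x∷xs]⇒x∉xs)
open import Data.List.Relation.Binary.Permutation.Propositional using (_↭_; ↭-refl; ↭-sym; ↭-trans; prep; ↭⇒↭ₛ)
open import Data.List.Relation.Binary.Permutation.Propositional.Properties
  using (∈-resp-↭; drop-mid; ↭-empty-inv; ↭-length; shift; map⁺)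
import Data.List.Relation.Binary.Permutation.Setoid.Properties as PermutationSetoid
open import Data.Nat using (ℕ; zero; suc; _+_; _≤_; _<_; z<s; s<s; s<s⁻¹; _<?_)
open import Data.Nat.Properties
  using (<-irrefl; <-trans; <-asym; <-cmp; n≮0; m≤m+n; suc-injective; ≤-refl; m<1+n⇒m<n∨m≡n; module ≤-Reasoning)
open import Data.Product using (_×_; _,_; proj₁; proj₂; ∃; ∃₂; uncurry)
open import Data.Product.Properties using (≡-dec)
open import Data.Sum using (_⊎_; inj₁; inj₂)
open import Function using (_∘_; id)
open import Function.Bundles using (Bijection; _⇔_; mk⇔)
open import Function.Definitions using (Injective)
open import Relation.Binary.Bundles using (Setoid)
open import Relation.Binary.Definitions using (DecidableEquality; Decidable; tri<; tri≈; tri>)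
open import Relation.Binary.Construct.Closure.Symmetric using (SymClosure; fwd; bwd)
open import Relation.Binary.Construct.Closure.ReflexiveTransitive using (ε; _◅_; _◅◅_)
open import Relation.Binary.Construct.Closure.Transitive using (TransClosure; [_]; _∷_)
import Relation.Binary.Construct.Closure.Equivalence as EquivalenceClosure
open import Relation.Binary.PropositionalEquality
  using (_≡_; _≢_; refl; sym; trans; cong; cong₂; subst; subst₂; ≢-sym; setoid; module ≡-Reasoning)
open import Relation.Nullary using (¬_; Dec; yes; no; does; proof; contradiction; _×-dec_; _⊎-dec_)
open import Relation.Nullary.Decidable using (dec-true; dec-false; recompute; decidable-stable; ¬?; does-⇔)
open import Relation.Nullary.Reflects using (Reflects; invert)

module FirstIndex {A : Set} (_≟_ : DecidableEquality A) where

  -- Position of the first occurrence of p; an absent p gets the length of the list.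
  indexOf : List A → A → ℕ
  indexOf []       p = 0
  indexOf (r ∷ rs) p = if does (r ≟ p) then 0 else suc (indexOf rs p)

  infix 4 _≺[_]_ _≺?[_]_

  _≺[_]_ : A → List A → A → Set
  p ≺[ L ] q = indexOf L p < indexOf L q

  _≺?[_]_ : ∀ p L q → Dec (p ≺[ L ] q)
  p ≺?[ L ] q = indexOf L p <? indexOf L q

  indexOf-head : ∀ p L → indexOf (p ∷ L) p ≡ 0
  indexOf-head p L rewrite dec-true (p ≟ p) refl = refl

  indexOf-tail : ∀ {r p} L → r ≢ p → indexOf (r ∷ L) p ≡ suc (indexOf L p)
  indexOf-tail {r} {p} L r≢p rewrite dec-false (r ≟ p) r≢p = refl

  indexOf<length : ∀ {p} L → p ∈ L → indexOf L p < length L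
  indexOf<length {p} (r ∷ L) p∈ with r ≟ p | p∈
  ... | yes _   | _         = z<s
  ... | no r≢p  | here p≡r  = contradiction (sym p≡r) r≢p
  ... | no _    | there p∈L = s<s (indexOf<length L p∈L)

  indexOf-++-∈ : ∀ {p} L M → p ∈ L → indexOf (L ++ M) p ≡ indexOf L p
  indexOf-++-∈ {p} (r ∷ L) M p∈ with r ≟ p | p∈
  ... | yes _  | _         = refl
  ... | no r≢p | here p≡r  = contradiction (sym p≡r) r≢p
  ... | no _   | there p∈L = cong suc (indexOf-++-∈ L M p∈L)

  indexOf-++-∉ : ∀ {p} L M → p ∉ L → indexOf (L ++ M) p ≡ length L + indexOf M p
  indexOf-++-∉ []      M p∉ = refl
  indexOf-++-∉ (r ∷ L) M p∉ =
    trans (indexOf-tail (L ++ M) (p∉ ∘ here ∘ sym)) (cong suc (indexOf-++-∉ L M (p∉ ∘ there)))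

  indexOf-injective : ∀ {p q} L → p ∈ L → indexOf L p ≡ indexOf L q → p ≡ q
  indexOf-injective {p} {q} (r ∷ L) p∈ eq with r ≟ p | r ≟ q | p∈
  ... | yes refl | yes r≡q | _         = r≡q
  ... | no r≢p   | _       | here p≡r  = contradiction (sym p≡r) r≢p
  ... | no _     | no _    | there p∈L = indexOf-injective L p∈L (suc-injective eq)

  ≺-head : ∀ {p q} L → p ≢ q → p ≺[ p ∷ L ] q
  ≺-head {p} L p≢q rewrite indexOf-head p L | indexOf-tail L p≢q = z<s

  ≮-head : ∀ {p q} L → ¬ p ≺[ q ∷ L ] q
  ≮-head {q = q} L rewrite indexOf-head q L = n≮0

  ≺-∷⁺ : ∀ {r p q} L → r ≢ p → r ≢ q → p ≺[ L ] q → p ≺[ r ∷ L ] q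
  ≺-∷⁺ L r≢p r≢q p≺q rewrite indexOf-tail L r≢p | indexOf-tail L r≢q = s<s p≺q

  ≺-∷⁻ : ∀ {r p q} L → r ≢ p → r ≢ q → p ≺[ r ∷ L ] q → p ≺[ L ] q
  ≺-∷⁻ L r≢p r≢q p≺q rewrite indexOf-tail L r≢p | indexOf-tail L r≢q = s<s⁻¹ p≺q

  ≺-second : ∀ {r p q} L → p ≢ q → r ≢ q → p ≺[ r ∷ p ∷ L ] q
  ≺-second {r} {p} {q} L p≢q r≢q = by-cases (r ≟ p)
    where
    by-cases : Dec (r ≡ p) → p ≺[ r ∷ p ∷ L ] q
    by-cases (yes r≡p) = subst (λ r → p ≺[ r ∷ p ∷ L ] q) (sym r≡p) (≺-head (p ∷ L) p≢q)
    by-cases (no r≢p)  = ≺-∷⁺ (p ∷ L) r≢p r≢q (≺-head L p≢q)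

  ≺-∷-mono : ∀ r {L L′ p q} → p ≢ q → (p ≺[ L ] q → p ≺[ L′ ] q) →
             p ≺[ r ∷ L ] q → p ≺[ r ∷ L′ ] q
  ≺-∷-mono r {L} {L′} {p} {q} p≢q mono p≺q = by-cases (r ≟ p) (r ≟ q)
    where
    by-cases : Dec (r ≡ p) → Dec (r ≡ q) → p ≺[ r ∷ L′ ] q
    by-cases (yes r≡p) _         = subst (λ r → p ≺[ r ∷ L′ ] q) (sym r≡p) (≺-head L′ p≢q)
    by-cases (no _)    (yes r≡q) = contradiction (subst (λ r → p ≺[ r ∷ L ] q) r≡q p≺q) (≮-head L)
    by-cases (no r≢p)  (no r≢q)  = ≺-∷⁺ L′ r≢p r≢q (mono (≺-∷⁻ L r≢p r≢q p≺q))

  ≺-++-mono : ∀ U {L L′ p q} → p ≢ q → (p ≺[ L ] q → p ≺[ L′ ] q) →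
              p ≺[ U ++ L ] q → p ≺[ U ++ L′ ] q
  ≺-++-mono []      p≢q mono = mono
  ≺-++-mono (r ∷ U) {L} {L′} p≢q mono = ≺-∷-mono r {U ++ L} {U ++ L′} p≢q (≺-++-mono U {L} {L′} p≢q mono)

  ≺-swap : ∀ {a b p q} v → p ≢ q → ¬ (p ≡ a × q ≡ b) → ¬ (p ≡ b × q ≡ a) →
           p ≺[ a ∷ b ∷ v ] q → p ≺[ b ∷ a ∷ v ] q
  ≺-swap {a} {b} {p} {q} v p≢q ¬ab ¬ba p≺q with p ≟ a | p ≟ b
  ... | yes refl | _        = ≺-second v p≢q (λ b≡q → ¬ab (refl , sym b≡q))
  ... | no _     | yes refl = ≺-head (a ∷ v) p≢q
  ... | no p≢a   | no p≢b with q ≟ a | q ≟ b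
  ...   | yes refl | _        = contradiction p≺q (≮-head (b ∷ v))
  ...   | no q≢a   | yes refl = contradiction (≺-∷⁻ (q ∷ v) (≢-sym p≢a) (≢-sym q≢a) p≺q) (≮-head v)
  ...   | no q≢a   | no q≢b   =
    ≺-∷⁺ (a ∷ v) (≢-sym p≢b) (≢-sym q≢b) (≺-∷⁺ v (≢-sym p≢a) (≢-sym q≢a)
      (≺-∷⁻ v (≢-sym p≢b) (≢-sym q≢b) (≺-∷⁻ (b ∷ v) (≢-sym p≢a) (≢-sym q≢a) p≺q)))

  ≺-prefix : ∀ U {V p q} → p ∈ U → q ∉ U → p ≺[ U ++ V ] q
  ≺-prefix U {V} {p} {q} p∈U q∉U = begin-strict
    indexOf (U ++ V) p      ≡⟨ indexOf-++-∈ U V p∈U ⟩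
    indexOf U p             <⟨ indexOf<length U p∈U ⟩
    length U                ≤⟨ m≤m+n (length U) (indexOf V q) ⟩
    length U + indexOf V q  ≡⟨ indexOf-++-∉ U V q∉U ⟨
    indexOf (U ++ V) q      ∎
    where open ≤-Reasoning

  ≺?-flip : ∀ {p q} L → p ∈ L → p ≢ q → does (p ≺?[ L ] q) ≡ not (does (q ≺?[ L ] p))
  ≺?-flip {p} {q} L p∈L p≢q with <-cmp (indexOf L p) (indexOf L q)
  ... | tri< p≺q _ q⊀p = trans (dec-true (p ≺?[ L ] q) p≺q) (cong not (sym (dec-false (q ≺?[ L ] p) q⊀p)))
  ... | tri≈ _ p≈q _   = contradiction (indexOf-injective L p∈L p≈q) p≢q
  ... | tri> p⊀q _ q≺p = trans (dec-false (p ≺?[ L ] q) p⊀q) (cong not (sym (dec-true (q ≺?[ L ] p) q≺p)))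

module _ {A B : Set} (_≟ᴬ_ : DecidableEquality A) (_≟ᴮ_ : DecidableEquality B) where
  private
    module IA = FirstIndex _≟ᴬ_
    module IB = FirstIndex _≟ᴮ_

  indexOf-map : ∀ {f : A → B} → Injective _≡_ _≡_ f → ∀ xs y → IB.indexOf (map f xs) (f y) ≡ IA.indexOf xs y
  indexOf-map f-inj []       y = refl
  indexOf-map {f} f-inj (r ∷ xs) y with r ≟ᴬ y | f r ≟ᴮ f y
  ... | yes _   | yes _    = refl
  ... | yes r≡y | no fr≢fy = contradiction (cong f r≡y) fr≢fy
  ... | no r≢y  | yes fr≡fy = contradiction (f-inj fr≡fy) r≢y
  ... | no _    | no _     = cong suc (indexOf-map f-inj xs y)

∈⇒↭-∷ : ∀ {A : Set} {y : A} {xs} → y ∈ xs → ∃ λ rest → xs ↭ y ∷ rest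
∈⇒↭-∷ {y = y} y∈xs with ys , zs , refl ← ∈-∃++ y∈xs = ys ++ zs , shift y ys zs

unique-resp-↭ : ∀ {A : Set} {xs ys : List A} → xs ↭ ys → Unique xs → Unique ys
unique-resp-↭ xs↭ys = PermutationSetoid.Unique-resp-↭ (setoid _) (↭⇒↭ₛ xs↭ys)

lookup-injective : ∀ {A : Set} {xs : List A} → Unique xs → Injective _≡_ _≡_ (lookup xs)
lookup-injective {xs = _ ∷ _} _               {Fin.zero}  {Fin.zero}  _  = refl
lookup-injective {xs = _ ∷ _} (x∉xs ∷ _)      {Fin.zero}  {Fin.suc b} eq = contradiction eq (All.lookup x∉xs (∈-lookup b))
lookup-injective {xs = _ ∷ _} (x∉xs ∷ _)      {Fin.suc a} {Fin.zero}  eq =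
  contradiction (sym eq) (All.lookup x∉xs (∈-lookup a))
lookup-injective {xs = _ ∷ _} (_ ∷ xs-unique) {Fin.suc a} {Fin.suc b} eq = cong Fin.suc (lookup-injective xs-unique eq)

module TopologicalSort {A : Set} (_≟_ : DecidableEquality A) {R : A → A → Set} (R? : Decidable R)
                       (acyclic : ∀ a → ¬ TransClosure R a a) where
  open FirstIndex _≟_

  -- Pigeonhole: walking backwards along predecessors inside xs revisits an element within length xs steps.
  predecessor-closed⇒cycle : ∀ {xs a} → a ∈ xs → (∀ {s} → s ∈ xs → ∃ λ r → r ∈ xs × R r s) →
                             ∃ λ c → TransClosure R c c
  predecessor-closed⇒cycle {xs} {a} a∈xs predecessor = repetition⇒cycle (pigeonhole ≤-refl position)
    where
    walk : ℕ → ∃ (_∈ xs)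
    walk zero    = a , a∈xs
    walk (suc k) = let r , r∈xs , _ = predecessor (proj₂ (walk k)) in r , r∈xs
    element : ℕ → A
    element k = proj₁ (walk k)
    step : ∀ k → R (element (suc k)) (element k)
    step k = proj₂ (proj₂ (predecessor (proj₂ (walk k))))
    path : ∀ {m n} → m < n → TransClosure R (element n) (element m)
    path {m} {suc n} m<1+n with m<1+n⇒m<n∨m≡n m<1+n
    ... | inj₁ m<n  = step n ∷ path m<n
    ... | inj₂ refl = [ step m ]
    position : Fin (suc (length xs)) → Fin (length xs)
    position k = index (proj₂ (walk (toℕ k)))
    same-element : ∀ k l → position k ≡ position l → element (toℕ k) ≡ element (toℕ l)
    same-element k l eq = trans (lookup-index (proj₂ (walk (toℕ k))))
      (trans (cong (lookup xs) eq) (sym (lookup-index (proj₂ (walk (toℕ l))))))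
    repetition⇒cycle : (∃₂ λ k l → toℕ k < toℕ l × position k ≡ position l) → ∃ λ c → TransClosure R c c
    repetition⇒cycle (k , l , k<l , same-position) = element (toℕ k) ,
      subst (λ c → TransClosure R c (element (toℕ k))) (sym (same-element k l same-position)) (path k<l)

  Source : List A → A → Set
  Source xs s = ¬ Any (λ r → R r s) xs

  has-source : ∀ {xs a} → a ∈ xs → ∃ λ s → s ∈ xs × Source xs s
  has-source {xs} a∈xs with any? (λ s → ¬? (any? (λ r → R? r s) xs)) xs
  ... | yes source = find source
  ... | no ¬source = ⊥-elim (uncurry acyclic (predecessor-closed⇒cycle a∈xs predecessor))
    where
    predecessor : ∀ {s} → s ∈ xs → ∃ λ r → r ∈ xs × R r s
    predecessor s∈xs = find (decidable-stable (any? (λ r → R? r _) xs) (¬source ∘ lose s∈xs))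

  Sorted : List A → List A → Set
  Sorted xs ws = ∀ {a b} → a ∈ xs → b ∈ xs → R a b → a ≺[ ws ] b

  topologicalSort : ∀ xs → ∃ λ ws → ws ↭ xs × Sorted xs ws
  topologicalSort xs = sortOfLength (length xs) xs refl
    where
    sortOfLength : ∀ k xs → length xs ≡ k → ∃ λ ws → ws ↭ xs × Sorted xs ws
    sortOfLength _       []       _   = [] , ↭-refl , λ ()
    sortOfLength (suc k) xs@(a ∷ _) len
      with s , s∈ , s-source ← has-source {xs} (here refl)
      with rest , xs↭s∷rest ← ∈⇒↭-∷ {xs = xs} s∈
      with ws , ws↭rest , ws-sorted ← sortOfLength k rest (suc-injective (trans (sym (↭-length xs↭s∷rest)) len))
      = s ∷ ws , ↭-trans (prep s ws↭rest) (↭-sym xs↭s∷rest) , sorted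
      where
      others : ∀ {c} → c ∈ xs → c ≢ s → c ∈ rest
      others c∈ c≢s with ∈-resp-↭ xs↭s∷rest c∈
      ... | here c≡s     = contradiction c≡s c≢s
      ... | there c∈rest = c∈rest
      sorted : Sorted xs (s ∷ ws)
      sorted {a} {b} a∈ b∈ Rab with a ≟ s | b ≟ s
      ... | _        | yes refl = contradiction (lose a∈ Rab) s-source
      ... | yes refl | no b≢s   = ≺-head ws (≢-sym b≢s)
      ... | no a≢s   | no b≢s   =
        ≺-∷⁺ ws (≢-sym a≢s) (≢-sym b≢s) (ws-sorted (others a∈ a≢s) (others b∈ b≢s) Rab)

_≟ₐ_ : DecidableEquality (ℕ × ℕ)
_≟ₐ_ = ≡-dec Data.Nat._≟_ Data.Nat._≟_

open FirstIndex _≟ₐ_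

Cross : ℕ × ℕ → ℕ × ℕ → Set
Cross p q = Crosses p q ⊎ Crosses q p

crosses? : ∀ p q → Dec (Crosses p q)
crosses? (i , j) (k , l) = i <? k ×-dec k <? j ×-dec j <? l

cross-sym : ∀ {p q} → Cross p q → Cross q p
cross-sym (inj₁ c) = inj₂ c
cross-sym (inj₂ c) = inj₁ c

cross⇒≢ : ∀ {p q} → Cross p q → p ≢ q
cross⇒≢ (inj₁ (i<k , _)) refl = <-irrefl refl i<k
cross⇒≢ (inj₂ (k<i , _)) refl = <-irrefl refl k<i

Disjoint : ℕ × ℕ → ℕ × ℕ → Set
Disjoint (i , j) (k , l) = i ≢ k × i ≢ l × j ≢ k × j ≢ l

disjoint-sym : ∀ {p q} → Disjoint p q → Disjoint q p
disjoint-sym (i≢k , i≢l , j≢k , j≢l) = ≢-sym i≢k , ≢-sym j≢k , ≢-sym i≢l , ≢-sym j≢l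

≺-swap-noncrossing : ∀ U V {C D p q} → ¬ Cross C D → Cross p q →
                     p ≺[ U ++ C ∷ D ∷ V ] q → p ≺[ U ++ D ∷ C ∷ V ] q
≺-swap-noncrossing U V {C} {D} {p} {q} C∤D p×q =
  ≺-++-mono U {C ∷ D ∷ V} {D ∷ C ∷ V} p≢q (≺-swap {C} {D} {p} {q} V p≢q not-CD not-DC)
  where
  p≢q : p ≢ q
  p≢q = cross⇒≢ p×q
  not-CD : ¬ (p ≡ C × q ≡ D)
  not-CD (refl , refl) = C∤D p×q
  not-DC : ¬ (p ≡ D × q ≡ C)
  not-DC (refl , refl) = C∤D (cross-sym p×q)

record PairwiseDisjoint (τ : List (ℕ × ℕ)) : Set where
  field
    unique   : Unique τ
    disjoint : ∀ {p q} → p ∈ τ → q ∈ τ → p ≢ q → Disjoint p q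
open PairwiseDisjoint

pairwiseDisjoint-resp-↭ : ∀ {τ τ′} → τ ↭ τ′ → PairwiseDisjoint τ → PairwiseDisjoint τ′
pairwiseDisjoint-resp-↭ τ↭τ′ τ-disjoint = record
  { unique   = unique-resp-↭ τ↭τ′ (unique τ-disjoint)
  ; disjoint = λ p∈ q∈ → disjoint τ-disjoint (∈-resp-↭ (↭-sym τ↭τ′) p∈) (∈-resp-↭ (↭-sym τ↭τ′) q∈)
  }

pairwiseDisjoint-tail : ∀ {p τ} → PairwiseDisjoint (p ∷ τ) → PairwiseDisjoint τ
pairwiseDisjoint-tail pτ-disjoint = record
  { unique   = AllPairs.tail (unique pτ-disjoint)
  ; disjoint = λ p∈ q∈ → disjoint pτ-disjoint (there p∈) (there q∈)
  }

endpoints : List (ℕ × ℕ) → List ℕ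
endpoints = concatMap (λ p → proj₁ p ∷ proj₂ p ∷ [])

∈-endpoints : ∀ {p τ} → p ∈ τ → proj₁ p ∈ endpoints τ × proj₂ p ∈ endpoints τ
∈-endpoints (here refl) = here refl , there (here refl)
∈-endpoints (there p∈τ) with k∈ , l∈ ← ∈-endpoints p∈τ = there (there k∈) , there (there l∈)

endpoints-unique⇒pairwiseDisjoint : ∀ τ → Unique (endpoints τ) → PairwiseDisjoint τ
endpoints-unique⇒pairwiseDisjoint []            _                              = record { unique = [] ; disjoint = λ () }
endpoints-unique⇒pairwiseDisjoint ((i , j) ∷ τ) ((_ ∷ i∉τ) ∷ j∉τ ∷ τ-endpoints-unique) = record
  { unique   = All.tabulate (λ q∈τ → proj₁ (apart q∈τ) ∘ cong proj₁) ∷ unique τ-disjoint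
  ; disjoint = λ where
      (here refl) (here refl) p≢q → contradiction refl p≢q
      (here refl) (there q∈τ) _   → apart q∈τ
      (there p∈τ) (here refl) _   → disjoint-sym (apart p∈τ)
      (there p∈τ) (there q∈τ) p≢q → disjoint τ-disjoint p∈τ q∈τ p≢q
  }
  where
  τ-disjoint : PairwiseDisjoint τ
  τ-disjoint = endpoints-unique⇒pairwiseDisjoint τ τ-endpoints-unique
  apart : ∀ {q} → q ∈ τ → Disjoint (i , j) q
  apart q∈τ with k∈ , l∈ ← ∈-endpoints q∈τ =
    All.lookup i∉τ k∈ , All.lookup i∉τ l∈ , All.lookup j∉τ k∈ , All.lookup j∉τ l∈

pairOf-injective : ∀ {a b} → pairOf a ≡ pairOf b → a ≡ b
pairOf-injective {x _ _ _ _} {x _ _ _ _} refl = refl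

letter-increasing : ∀ a → i a < j a
letter-increasing (x k l _ k<l) = recompute (k <? l) k<l

Commuting : Letter → Letter → Set
Commuting a b = Commute a b ⊎ Commute b a

commute⇒noncrossing : ∀ a b → Commute a b → ¬ Cross (pairOf a) (pairOf b)
commute⇒noncrossing a b (inj₁ j<k) (inj₁ (_ , k<j , _)) = <-asym j<k k<j
commute⇒noncrossing a b (inj₁ j<k) (inj₂ (k<i , _))     =
  <-irrefl refl (<-trans (letter-increasing a) (<-trans j<k k<i))
commute⇒noncrossing a b (inj₂ (_ , l<j)) (inj₁ (_ , _ , j<l)) = <-asym l<j j<l
commute⇒noncrossing a b (inj₂ (i<k , _)) (inj₂ (k<i , _))     = <-asym i<k k<i

-- Two disjoint arches either cross, are nested, or lie side by side;
-- the last two cases are the defining relations of M.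
disjoint-noncrossing⇒commuting : ∀ a b → Disjoint (pairOf a) (pairOf b) → ¬ Cross (pairOf a) (pairOf b) →
                                  Commuting a b
disjoint-noncrossing⇒commuting a b (i≢k , i≢l , j≢k , j≢l) a∤b with <-cmp (j a) (i b)
... | tri< j<k _ _ = inj₁ (inj₁ j<k)
... | tri≈ _ j≡k _ = contradiction j≡k j≢k
... | tri> _ _ k<j with <-cmp (i a) (i b)
...   | tri≈ _ i≡k _ = contradiction i≡k i≢k
...   | tri< i<k _ _ with <-cmp (j a) (j b)
...     | tri< j<l _ _ = contradiction (inj₁ (i<k , k<j , j<l)) a∤b
...     | tri≈ _ j≡l _ = contradiction j≡l j≢l
...     | tri> _ _ l<j = inj₁ (inj₂ (i<k , l<j))
disjoint-noncrossing⇒commuting a b (i≢k , i≢l , j≢k , j≢l) a∤b | tri> _ _ k<j | tri> _ _ k<i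
  with <-cmp (j b) (i a)
...     | tri< l<i _ _ = inj₂ (inj₁ l<i)
...     | tri≈ _ l≡i _ = contradiction (sym l≡i) i≢l
...     | tri> _ _ i<l with <-cmp (j b) (j a)
...       | tri< l<j _ _ = contradiction (inj₂ (k<i , i<l , l<j)) a∤b
...       | tri≈ _ l≡j _ = contradiction (sym l≡j) j≢l
...       | tri> _ _ j<l = inj₂ (inj₂ (k<i , j<l))

≈M-∷ : ∀ c {w w′} → w ≈M w′ → (c ∷ w) ≈M (c ∷ w′)
≈M-∷ c = EquivalenceClosure.gmap (c ∷_) prepend
  where
  prepend : ∀ {w w′} → Step w w′ → Step (c ∷ w) (c ∷ w′)
  prepend (swap u v a b a⇄b) = swap (c ∷ u) v a b a⇄b

commute-to-front : ∀ u {a v} → All (λ c → Commuting c a) u → (u ++ a ∷ v) ≈M (a ∷ u ++ v)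
commute-to-front []      _                = ε
commute-to-front (c ∷ u) {a} {v} (c⇄a ∷ u⇄a) = ≈M-∷ c (commute-to-front u u⇄a) ◅◅ swap-front c⇄a ◅ ε
  where
  swap-front : Commuting c a → SymClosure Step (c ∷ a ∷ u ++ v) (a ∷ c ∷ u ++ v)
  swap-front (inj₁ c⇄a) = fwd (swap [] (u ++ v) c a c⇄a)
  swap-front (inj₂ a⇄c) = bwd (swap [] (u ++ v) a c a⇄c)

CrossingsAgree : List (ℕ × ℕ) → List (ℕ × ℕ) → Set
CrossingsAgree L L′ = ∀ {p q} → p ∈ L → q ∈ L → Cross p q → p ≺[ L ] q → p ≺[ L′ ] q

Φ-split : ∀ {a} w → pairOf a ∈ Φ w → ∃₂ λ u v → w ≡ u ++ a ∷ v
Φ-split {a} w a∈ with a′ , a′∈w , a≡a′ ← ∈-map⁻ pairOf a∈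
  with refl ← pairOf-injective {a} {a′} a≡a′ = ∈-∃++ a′∈w

crossingsAgree-drop : ∀ {A L} U V → A ∉ L → CrossingsAgree (A ∷ L) (U ++ A ∷ V) → CrossingsAgree L (U ++ V)
crossingsAgree-drop {A} {L} U V A∉L agree {p} {q} p∈ q∈ p×q p≺q =
  ≺-++-mono U {A ∷ V} {V} (cross⇒≢ p×q) (≺-∷⁻ V A≢p A≢q)
    (agree (there p∈) (there q∈) p×q (≺-∷⁺ L A≢p A≢q p≺q))
  where
  A≢p : A ≢ p
  A≢p A≡p = A∉L (subst (_∈ L) (sym A≡p) p∈)
  A≢q : A ≢ q
  A≢q A≡q = A∉L (subst (_∈ L) (sym A≡q) q∈)

-- The first letter a of w occurs in w′ = u a v; no letter of u crosses a (the order of a crossing pair would differ),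
-- so a commutes to the front of w′ and we recurse on the rest.
≈M-if-crossings-agree : ∀ w w′ → PairwiseDisjoint (Φ w) → Φ w ↭ Φ w′ → CrossingsAgree (Φ w) (Φ w′) →
                        w ≈M w′
≈M-if-crossings-agree []      []      _ _     _ = ε
≈M-if-crossings-agree []      (_ ∷ _) _ w↭w′ _ with () ← ↭-empty-inv (↭-sym w↭w′)
≈M-if-crossings-agree (a ∷ w) w′ aw-disjoint aw↭w′ agree
  with u , v , refl ← Φ-split {a} w′ (∈-resp-↭ aw↭w′ (here refl))
  rewrite map-++ pairOf u (a ∷ v) =
  ≈M-∷ a (≈M-if-crossings-agree w (u ++ v) (pairwiseDisjoint-tail aw-disjoint) w↭uv agree-tail)
  ◅◅ EquivalenceClosure.symmetric Step (commute-to-front u (All.tabulate u-commutes))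
  where
  A : ℕ × ℕ
  A = pairOf a
  A∉w : A ∉ Φ w
  A∉w = Unique[x∷xs]⇒x∉xs (unique aw-disjoint)
  w↭uv′ : Φ w ↭ Φ u ++ Φ v
  w↭uv′ = drop-mid [] (Φ u) aw↭w′
  w↭uv : Φ w ↭ Φ (u ++ v)
  w↭uv = subst (Φ w ↭_) (sym (map-++ pairOf u v)) w↭uv′
  A∉u : A ∉ Φ u
  A∉u A∈u = A∉w (∈-resp-↭ (↭-sym w↭uv′) (∈-++⁺ˡ A∈u))
  agree-tail : CrossingsAgree (Φ w) (Φ (u ++ v))
  agree-tail = subst (CrossingsAgree (Φ w)) (sym (map-++ pairOf u v)) (crossingsAgree-drop (Φ u) (Φ v) A∉w agree)
  u-commutes : ∀ {c} → c ∈ u → Commuting c a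
  u-commutes {c} c∈u = disjoint-noncrossing⇒commuting c a
    (disjoint (pairwiseDisjoint-resp-↭ aw↭w′ aw-disjoint) C∈w′ (∈-++⁺ʳ (Φ u) (here refl)) C≢A) C∤A
    where
    C : ℕ × ℕ
    C = pairOf c
    C∈u : C ∈ Φ u
    C∈u = ∈-map⁺ pairOf c∈u
    C∈w′ : C ∈ Φ u ++ A ∷ Φ v
    C∈w′ = ∈-++⁺ˡ C∈u
    C≢A : C ≢ A
    C≢A C≡A = A∉u (subst (_∈ Φ u) C≡A C∈u)
    C∤A : ¬ Cross C A
    C∤A C×A = <-asym (≺-prefix (Φ u) C∈u A∉u)
      (agree (here refl) (∈-resp-↭ (↭-sym aw↭w′) C∈w′) (cross-sym C×A) (≺-head (Φ w) (≢-sym C≢A)))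

module CrossingOrientation (σ : List (ℕ × ℕ)) (σ-disjoint : PairwiseDisjoint σ)
                           (σ-positive : All (λ p → 1 ≤ proj₁ p) σ)
                           (σ-increasing : All (λ p → proj₁ p < proj₂ p) σ) where

  n : ℕ
  n = length σ

  edge? : ∀ a b → Dec (Edge σ a b)
  edge? a b = crosses? (Arch σ a) (Arch σ b) ⊎-dec crosses? (Arch σ b) (Arch σ a)

  orientationOf : List (ℕ × ℕ) → Fin n → Fin n → Bool
  orientationOf L a b = does (edge? a b ×-dec Arch σ a ≺?[ L ] Arch σ b)

  orientationOf-edge : ∀ L {a b} → Edge σ a b → orientationOf L a b ≡ does (Arch σ a ≺?[ L ] Arch σ b)
  orientationOf-edge L {a} {b} a×b = cong (_∧ does (Arch σ a ≺?[ L ] Arch σ b)) (dec-true (edge? a b) a×b)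

  orientationOf-nonedge : ∀ L {a b} → ¬ Edge σ a b → orientationOf L a b ≡ false
  orientationOf-nonedge L {a} {b} ¬a×b = cong (_∧ does (Arch σ a ≺?[ L ] Arch σ b)) (dec-false (edge? a b) ¬a×b)

  orientationOf-true : ∀ L {a b} → orientationOf L a b ≡ true → Arch σ a ≺[ L ] Arch σ b
  orientationOf-true L {a} {b} a→b =
    proj₂ (invert (subst (Reflects _) a→b (proof (edge? a b ×-dec Arch σ a ≺?[ L ] Arch σ b))))

  orientationOf-≺ : ∀ L {a b} → Edge σ a b → Arch σ a ≺[ L ] Arch σ b → orientationOf L a b ≡ true
  orientationOf-≺ L {a} {b} a×b a≺b = dec-true (edge? a b ×-dec Arch σ a ≺?[ L ] Arch σ b) (a×b , a≺b)

  orientationOf-cong : ∀ L L′ →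
                       (∀ {a b} → Edge σ a b → Arch σ a ≺[ L ] Arch σ b ⇔ Arch σ a ≺[ L′ ] Arch σ b) →
                       ∀ a b → orientationOf L a b ≡ orientationOf L′ a b
  orientationOf-cong L L′ same a b = by-cases (edge? a b)
    where
    by-cases : Dec (Edge σ a b) → orientationOf L a b ≡ orientationOf L′ a b
    by-cases (yes a×b) = begin
      orientationOf L a b                ≡⟨ orientationOf-edge L a×b ⟩
      does (Arch σ a ≺?[ L ] Arch σ b)   ≡⟨ does-⇔ (same a×b) (Arch σ a ≺?[ L ] Arch σ b)
                                                               (Arch σ a ≺?[ L′ ] Arch σ b) ⟩
      does (Arch σ a ≺?[ L′ ] Arch σ b)  ≡⟨ orientationOf-edge L′ a×b ⟨
      orientationOf L′ a b                ∎
      where open ≡-Reasoning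
    by-cases (no ¬a×b) = trans (orientationOf-nonedge L ¬a×b) (sym (orientationOf-nonedge L′ ¬a×b))

  orientation : ∀ L → (∀ a → Arch σ a ∈ L) → AcyclicOrientation σ
  orientation L σ⊆L = record
    { dir     = orientationOf L
    ; onEdge  = λ a b a×b → begin
        orientationOf L a b                     ≡⟨ orientationOf-edge L a×b ⟩
        does (Arch σ a ≺?[ L ] Arch σ b)        ≡⟨ ≺?-flip L (σ⊆L a) (cross⇒≢ a×b) ⟩
        not (does (Arch σ b ≺?[ L ] Arch σ a))  ≡⟨ cong not (orientationOf-edge L (cross-sym a×b)) ⟨
        not (orientationOf L b a)               ∎
    ; offEdge = λ a b → orientationOf-nonedge L
    ; acyclic = λ a a↝a → <-irrefl refl (path⇒≺ a↝a)
    }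
    where
    open ≡-Reasoning
    path⇒≺ : ∀ {a b} → TransClosure (λ c d → orientationOf L c d ≡ true) a b → Arch σ a ≺[ L ] Arch σ b
    path⇒≺ [ a→b ]      = orientationOf-true L a→b
    path⇒≺ (a→b ∷ b↝c) = <-trans (orientationOf-true L a→b) (path⇒≺ b↝c)

  orientationOf-step : ∀ {w w′} → Step w w′ → ∀ a b → orientationOf (Φ w) a b ≡ orientationOf (Φ w′) a b
  orientationOf-step (swap u v c d c⇄d) rewrite map-++ pairOf u (c ∷ d ∷ v) | map-++ pairOf u (d ∷ c ∷ v) =
    orientationOf-cong (Φ u ++ pairOf c ∷ pairOf d ∷ Φ v) (Φ u ++ pairOf d ∷ pairOf c ∷ Φ v) λ a×b →
      mk⇔ (≺-swap-noncrossing (Φ u) (Φ v) c∤d a×b) (≺-swap-noncrossing (Φ u) (Φ v) (c∤d ∘ cross-sym) a×b)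
    where
    c∤d : ¬ Cross (pairOf c) (pairOf d)
    c∤d = commute⇒noncrossing c d c⇄d

  orientationOf-≈M : ∀ {w w′} → w ≈M w′ → ∀ a b → orientationOf (Φ w) a b ≡ orientationOf (Φ w′) a b
  orientationOf-≈M ε                 a b = refl
  orientationOf-≈M (fwd w→w′ ◅ w′≈) a b = trans (orientationOf-step w→w′ a b) (orientationOf-≈M w′≈ a b)
  orientationOf-≈M (bwd w′→w ◅ w′≈) a b = trans (sym (orientationOf-step w′→w a b)) (orientationOf-≈M w′≈ a b)

  heapOrientation : Setoid.Carrier (HeapsWithΦ σ) → AcyclicOrientation σ
  heapOrientation (w , w↭σ) = orientation (Φ w) (λ a → ∈-resp-↭ (↭-sym w↭σ) (∈-lookup a))

  arch-index : ∀ {p} → p ∈ σ → ∃ λ a → Arch σ a ≡ p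
  arch-index p∈σ = index p∈σ , sym (lookup-index p∈σ)

  heapOrientation-injective : ∀ {w w′} → (∀ a b → dir (heapOrientation w) a b ≡ dir (heapOrientation w′) a b) →
                              proj₁ w ≈M proj₁ w′
  heapOrientation-injective {w , w↭σ} {w′ , w′↭σ} same =
    ≈M-if-crossings-agree w w′ (pairwiseDisjoint-resp-↭ (↭-sym w↭σ) σ-disjoint) (↭-trans w↭σ (↭-sym w′↭σ))
      agree
    where
    agree : CrossingsAgree (Φ w) (Φ w′)
    agree p∈ q∈ p×q p≺q
      with a , refl ← arch-index (∈-resp-↭ w↭σ p∈)
      with b , refl ← arch-index (∈-resp-↭ w↭σ q∈)
      = orientationOf-true (Φ w′) (trans (sym (same a b)) (orientationOf-≺ (Φ w) p×q p≺q))

  letterAt : Fin n → Letter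
  letterAt a = x (proj₁ (Arch σ a)) (proj₂ (Arch σ a))
                 (All.lookup σ-positive (∈-lookup a)) (All.lookup σ-increasing (∈-lookup a))

  module Realization (o : AcyclicOrientation σ) where
    open TopologicalSort Fin._≟_ (λ a b → dir o a b Bool.≟ true) (acyclic o)
    module FinIndex = FirstIndex (Fin._≟_ {n})

    ws : List (Fin n)
    ws = proj₁ (topologicalSort (allFin n))

    ws-sorted : Sorted (allFin n) ws
    ws-sorted = proj₂ (proj₂ (topologicalSort (allFin n)))

    Φ-word : Φ (map letterAt ws) ≡ map (Arch σ) ws
    Φ-word = sym (map-∘ ws)

    heap : Setoid.Carrier (HeapsWithΦ σ)
    heap = map letterAt ws , subst₂ _↭_ (sym Φ-word) (trans (map-tabulate id (Arch σ)) (tabulate-lookup σ))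
                                      (map⁺ (Arch σ) (proj₁ (proj₂ (topologicalSort (allFin n)))))

    ≺?-Arch : ∀ a b → does (Arch σ a ≺?[ map (Arch σ) ws ] Arch σ b) ≡ does (a FinIndex.≺?[ ws ] b)
    ≺?-Arch a b = cong₂ (λ m k → does (m <? k)) (indexOf-map Fin._≟_ _≟ₐ_ Arch-injective ws a)
                                                 (indexOf-map Fin._≟_ _≟ₐ_ Arch-injective ws b)
      where
      Arch-injective : Injective _≡_ _≡_ (Arch σ)
      Arch-injective = lookup-injective (unique σ-disjoint)

    sorted-agrees : ∀ {a b} → Edge σ a b → does (a FinIndex.≺?[ ws ] b) ≡ dir o a b
    sorted-agrees {a} {b} a×b = by-cases (dir o a b) refl
      where
      by-cases : ∀ d → dir o a b ≡ d → does (a FinIndex.≺?[ ws ] b) ≡ dir o a b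
      by-cases true  a→b =
        trans (dec-true (a FinIndex.≺?[ ws ] b) (ws-sorted (∈-allFin a) (∈-allFin b) a→b)) (sym a→b)
      by-cases false a↛b = trans (dec-false (a FinIndex.≺?[ ws ] b) b≺a⇒a⊀b) (sym a↛b)
        where
        b→a : dir o b a ≡ true
        b→a = not-injective (trans (sym (onEdge o a b a×b)) a↛b)
        b≺a⇒a⊀b : ¬ a FinIndex.≺[ ws ] b
        b≺a⇒a⊀b a≺b = <-asym a≺b (ws-sorted (∈-allFin b) (∈-allFin a) b→a)

    heap-orientation : ∀ a b → dir (heapOrientation heap) a b ≡ dir o a b
    heap-orientation a b = trans (cong (λ L → orientationOf L a b) Φ-word) (by-cases (edge? a b))
      where
      by-cases : Dec (Edge σ a b) → orientationOf (map (Arch σ) ws) a b ≡ dir o a b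
      by-cases (yes a×b) = trans (orientationOf-edge (map (Arch σ) ws) a×b) (trans (≺?-Arch a b) (sorted-agrees a×b))
      by-cases (no ¬a×b) = trans (orientationOf-nonedge (map (Arch σ) ws) ¬a×b) (sym (offEdge o a b ¬a×b))

  bijection : Bijection (HeapsWithΦ σ) (AcyclicOrientations σ)
  bijection = record
    { to        = heapOrientation
    ; cong      = λ {w} {w′} → orientationOf-≈M
    ; bijective = (λ {w} {w′} → heapOrientation-injective {w} {w′})
                , λ o → Realization.heap o ,
                        λ {w} w≈ a b → trans (orientationOf-≈M w≈ a b) (Realization.heap-orientation o a b)
    }

lemma5p6 : (V : List ℕ) → IsPosFinSet V →
           (σ : List (ℕ × ℕ)) → IsMatching V σ →
           Bijection (HeapsWithΦ σ) (AcyclicOrientations σ)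
lemma5p6 V (V-unique , V-positive) σ (σ-increasing , endpoints↭V) =
  CrossingOrientation.bijection σ σ-disjoint σ-positive σ-increasing
  where
  σ-disjoint : PairwiseDisjoint σ
  σ-disjoint = endpoints-unique⇒pairwiseDisjoint σ (unique-resp-↭ (↭-sym endpoints↭V) V-unique)
  σ-positive : All (λ p → 1 ≤ proj₁ p) σ
  σ-positive = All.tabulate λ p∈σ → All.lookup V-positive (∈-resp-↭ endpoints↭V (proj₁ (∈-endpoints p∈σ)))
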